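{- Let $k,m,q$ be positive integers with $q\ge k-8$ and $\beta(2k,m,q)\ne0$. Then either $m\ge k+q-3$, or else $q=k-8$, $m=2k-12$, $k\ge9$ and $\beta(2k,2k-12,k-8)=36(k-8)$.
   Context: $S_m$ is the group of permutations of $\{1,\dots,m\}$ in one-line notation. For $\pi\in S_a$, $\tau\in S_b$, the concatenation is $\pi+\tau=(\pi(1)\ldots\pi(a)\,(a+\tau(1))\ldots(a+\tau(b)))\in S_{a+b}$. A permutation is connected if it is not of the form $\pi+\tau$ with $\pi\in S_a,\tau\in S_b$, $a,b\ge1$; each permutation is uniquely a concatenation of connected permutations (split decomposition). A split type in $S_m$ is a permutation $\sigma\in S_m$ all of whose split-decomposition parts are nontrivial (not $(1)\in S_1$); $q(\sigma)$ is the number of parts. For $\sigma\in S_m$, $\ell_1(\sigma)=\sum_{i=1}^m|\sigma(i)-i|$. $\beta(R,m,q)$ denotes the number of split types $\sigma\in S_m$ with $\ell_1(\sigma)=R$ and $q(\sigma)=q$. -}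

module Defs where

open import Data.Bool using (Bool; true; false; _∧_; not)
open import Data.Nat using (ℕ; zero; suc; _+_; _≡ᵇ_; _<ᵇ_; ∣_-_∣)
open import Data.List using (List; []; _∷_; length; map; concatMap; upTo; filterᵇ; take; zipWith)
open import Data.Bool.ListAction using (all; any)
open import Data.Nat.ListAction using (sum)

-- Permutations of {0,…,m-1} in one-line notation (0-indexed; shifting by 1
-- changes nothing below), represented as lists of naturals.

words : ℕ → ℕ → List (List ℕ)
words m zero    = [] ∷ []
words m (suc n) = concatMap (λ x → map (x ∷_) (words m n)) (upTo m)

distinct : List ℕ → Bool
distinct []       = true
distinct (x ∷ xs) = not (any (x ≡ᵇ_) xs) ∧ distinct xs

perms : ℕ → List (List ℕ)
perms m = filterᵇ distinct (words m m)

-- σ has a "cut" at position a (0 ≤ a ≤ m) iff σ maps {0,…,a-1} into {0,…,a-1},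
-- i.e. σ = π + τ with π ∈ S_a, τ ∈ S_{m-a}.  Cuts at 0 and m always hold.
cut : List ℕ → ℕ → Bool
cut σ a = all (λ x → x <ᵇ a) (take a σ)

-- the parts of the split decomposition are exactly the intervals between
-- consecutive cuts, so the number of parts is the number of cuts a ∈ {1,…,m}
q : List ℕ → ℕ
q σ = length (filterᵇ (cut σ) (map suc (upTo (length σ))))

-- split type: no part of size 1, i.e. no i with cuts at both i and i+1
isSplitType : List ℕ → Bool
isSplitType σ = not (any (λ i → cut σ i ∧ cut σ (suc i)) (upTo (length σ)))

ℓ₁ : List ℕ → ℕ
ℓ₁ σ = sum (zipWith ∣_-_∣ σ (upTo (length σ)))

β : ℕ → ℕ → ℕ → ℕ
β R m q′ = length (filterᵇ (λ σ → isSplitType σ ∧ (ℓ₁ σ ≡ᵇ R) ∧ (q σ ≡ᵇ q′)) (perms m))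

module Submission where

-- Every part of a split type has size ≥ 2, so a split type σ ∈ S_m with q parts has
-- m = 2q + h for an excess h ≥ 0.  Peeling off the first part π ∈ S_p (p = 2 + r) and using
-- 2ℓ₁(π) ≤ p² for p ≤ 6 (checked by enumerating S_p) gives, by induction, the key inequality
--     h ≤ 4  ⇒  2ℓ₁(σ) ≤ h² + 4h + 4q.
-- With ℓ₁ = 2k and m + 3 < k + q′ it forces h = 4 and k = q′ + 8.  In this extremal case,
-- peeling the first part off a member of level t + 1 (size 2t + 6, t + 1 parts, ℓ₁ = 2t + 18)
-- leaves either the transposition 21 followed by a member of level t, or one of the 36
-- permutations of S_6 with ℓ₁ = 18 followed by 21 43 … (t copies, the only split type of S_{2t}
-- with t parts).  So each level adds 36, and level t has 36t members.

open import Defs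
open import Data.Bool using (Bool; true; false; _∧_; _∨_; not; T; T?)
open import Data.Bool.Properties using (T-∧)
open import Data.Bool.ListAction using (or; all)
open import Data.Nat using (ℕ; zero; suc; _+_; _*_; _∸_; _⊓_; _≤_; _<_; z≤n; s≤s; _≡ᵇ_; _<ᵇ_; _≤ᵇ_; _≤?_; ∣_-_∣)
open import Data.Nat.Properties
open import Data.Nat.ListAction using (sum)
open import Data.Nat.ListAction.Properties using (sum-++)
open import Data.Nat.Tactic.RingSolver using (solve-∀)
open import Data.List using (List; []; _∷_; length; map; concatMap; cartesianProductWith; applyUpTo; upTo; filterᵇ; take; drop; zipWith; _++_)
open import Data.List.Properties
  using ( length-upTo; map-upTo; map-∘; map-cong; map-cong-local; map-id-local; map-injective
        ; length-++; length-map; length-drop; length-take; take-map; take-all; take-take; take++drop≡id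
        ; zipWith-map; zipWith-cong; ++-cancelˡ; ++-cancelʳ )
open import Data.List.Relation.Unary.All as All using (All; []; _∷_)
import Data.List.Relation.Unary.All.Properties as AllP
open import Data.List.Relation.Unary.All.Properties using (¬Any⇒All¬; All¬⇒¬Any; all⁺; all⁻; all-upTo)
open import Data.List.Relation.Unary.Any using (here; there)
open import Data.List.Relation.Unary.Any.Properties using (any⁺; any⁻)
open import Data.List.Membership.Propositional using (_∈_; _∉_)
open import Data.List.Membership.Propositional.Properties
  using ( ∈-upTo⁺; ∈-upTo⁻; ∈-filter⁺; ∈-filter⁻; ∈-cartesianProductWith⁺; ∈-cartesianProductWith⁻
        ; ∈-map⁺; ∈-map⁻; ∈-++⁺ˡ; ∈-++⁺ʳ; ∈-++⁻ )
open import Data.List.Membership.DecPropositional _≟_ using (_∈?_)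
open import Data.List.Relation.Unary.Unique.Propositional using (Unique)
import Data.List.Relation.Unary.Unique.Propositional.Properties as Unique
open import Data.List.Relation.Unary.AllPairs using ([]; _∷_)
open import Data.Product using (∃; _×_; _,_; proj₁)
open import Data.Sum using (_⊎_; inj₁; inj₂)
open import Data.Empty using (⊥; ⊥-elim)
open import Function using (_∘_; Equivalence)
open import Relation.Nullary using (¬_; yes; no)
open import Relation.Binary.PropositionalEquality

T-not⇒¬T : ∀ {b} → T (not b) → ¬ T b
T-not⇒¬T {false} _ ()

¬T⇒T-not : ∀ {b} → ¬ T b → T (not b)
¬T⇒T-not {false} _ = _
¬T⇒T-not {true} ¬t = ¬t _

words-suc : ∀ m n → words m (suc n) ≡ cartesianProductWith _∷_ (upTo m) (words m n)
words-suc m n = go (upTo m)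
  where
  go : ∀ xs → concatMap (λ x → map (x ∷_) (words m n)) xs ≡ cartesianProductWith _∷_ xs (words m n)
  go [] = refl
  go (x ∷ xs) = cong (map (x ∷_) (words m n) ++_) (go xs)

∈-words⁻ : ∀ {m} n {σ} → σ ∈ words m n → length σ ≡ n × All (_< m) σ
∈-words⁻ zero (here refl) = refl , []
∈-words⁻ {m} (suc n) σ∈ rewrite words-suc m n
  with x , τ , x∈ , τ∈ , refl ← ∈-cartesianProductWith⁻ _∷_ (upTo m) (words m n) σ∈
  with len , bnd ← ∈-words⁻ n τ∈ = cong suc len , ∈-upTo⁻ x∈ ∷ bnd

∈-words⁺ : ∀ {m} n {σ} → length σ ≡ n → All (_< m) σ → σ ∈ words m n
∈-words⁺ zero {[]} _ _ = here refl
∈-words⁺ {m} (suc n) {x ∷ σ} len (x<m ∷ bnd) rewrite words-suc m n =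
  ∈-cartesianProductWith⁺ _∷_ (∈-upTo⁺ x<m) (∈-words⁺ n (suc-injective len) bnd)

words-unique : ∀ m n → Unique (words m n)
words-unique m zero = [] ∷ []
words-unique m (suc n) rewrite words-suc m n =
  Unique.cartesianProductWith⁺ _∷_ (λ { refl → refl , refl }) (Unique.upTo⁺ m) (words-unique m n)

distinct⇒Unique : ∀ xs → T (distinct xs) → Unique xs
distinct⇒Unique [] _ = []
distinct⇒Unique (x ∷ xs) t with Equivalence.to T-∧ t
... | fresh , rest =
  All.map (λ ¬x≡ᵇy x≡y → ¬x≡ᵇy (≡⇒≡ᵇ _ _ x≡y)) (¬Any⇒All¬ xs (T-not⇒¬T fresh ∘ any⁺ _))
  ∷ distinct⇒Unique xs rest

Unique⇒distinct : ∀ xs → Unique xs → T (distinct xs)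
Unique⇒distinct [] _ = _
Unique⇒distinct (x ∷ xs) (x∉xs ∷ u) =
  Equivalence.from T-∧
    ( ¬T⇒T-not (All¬⇒¬Any (All.map (λ x≢y → x≢y ∘ ≡ᵇ⇒≡ _ _) x∉xs) ∘ any⁻ _ xs)
    , Unique⇒distinct xs u )

record IsPerm (m : ℕ) (σ : List ℕ) : Set where
  constructor isPerm
  field
    len  : length σ ≡ m
    bnd  : All (_< m) σ
    uniq : Unique σ

∈-perms⁻ : ∀ {m σ} → σ ∈ perms m → IsPerm m σ
∈-perms⁻ {m} σ∈ with w∈ , d ← ∈-filter⁻ (T? ∘ distinct) {xs = words m m} σ∈
  with len , bnd ← ∈-words⁻ m w∈ = isPerm len bnd (distinct⇒Unique _ d)

∈-perms⁺ : ∀ {m σ} → IsPerm m σ → σ ∈ perms m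
∈-perms⁺ {m} (isPerm len bnd u) =
  ∈-filter⁺ (T? ∘ distinct) {xs = words m m} (∈-words⁺ m len bnd) (Unique⇒distinct _ u)

perms-unique : ∀ m → Unique (perms m)
perms-unique m = Unique.filter⁺ (T? ∘ distinct) (words-unique m m)

remove : ∀ {A : Set} {x : A} ys → x ∈ ys →
         ∃ λ ys′ → length ys ≡ suc (length ys′) × (∀ {z} → z ∈ ys → z ≢ x → z ∈ ys′)
remove (y ∷ ys) (here refl) = ys , refl , λ { (here refl) z≢x → ⊥-elim (z≢x refl) ; (there z∈) _ → z∈ }
remove (y ∷ ys) (there x∈) with ys′ , len , keep ← remove ys x∈ =
  y ∷ ys′ , cong suc len , λ { (here refl) _ → here refl ; (there z∈) z≢x → there (keep z∈ z≢x) }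

Unique-⊆⇒length≤ : ∀ {A : Set} {xs ys : List A} → Unique xs → (∀ {z} → z ∈ xs → z ∈ ys) → length xs ≤ length ys
Unique-⊆⇒length≤ {xs = []} _ _ = z≤n
Unique-⊆⇒length≤ {xs = x ∷ xs} {ys} (x∉xs ∷ u) xs⊆ys
  with ys′ , len , keep ← remove ys (xs⊆ys (here refl)) =
  subst (suc (length xs) ≤_) (sym len)
    (s≤s (Unique-⊆⇒length≤ u (λ z∈xs → keep (xs⊆ys (there z∈xs)) (λ { refl → All.lookup x∉xs z∈xs refl }))))

Unique-≈⇒length≡ : ∀ {A : Set} {xs ys : List A} → Unique xs → Unique ys →
                   (∀ {z} → z ∈ xs → z ∈ ys) → (∀ {z} → z ∈ ys → z ∈ xs) → length xs ≡ length ys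
Unique-≈⇒length≡ uxs uys xs⊆ys ys⊆xs = ≤-antisym (Unique-⊆⇒length≤ uxs xs⊆ys) (Unique-⊆⇒length≤ uys ys⊆xs)

Unique-bounded⇒complete : ∀ {p xs} → length xs ≡ p → All (_< p) xs → Unique xs → ∀ {v} → v < p → v ∈ xs
Unique-bounded⇒complete {p} {xs} len bnd u {v} v<p with v ∈? xs
... | yes v∈xs = v∈xs
... | no v∉xs = ⊥-elim (<-irrefl refl (begin-strict
      p                 ≡⟨ sym len ⟩
      length xs         <⟨ n<1+n _ ⟩
      length (v ∷ xs)   ≤⟨ Unique-⊆⇒length≤ (All.tabulate (λ v′∈ v≡v′ → v∉xs (subst (_∈ xs) (sym v≡v′) v′∈)) ∷ u) v∷xs⊆upTo ⟩
      length (upTo p)   ≡⟨ length-upTo p ⟩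
      p                 ∎))
  where
  open ≤-Reasoning
  v∷xs⊆upTo : ∀ {z} → z ∈ v ∷ xs → z ∈ upTo p
  v∷xs⊆upTo (here refl) = ∈-upTo⁺ v<p
  v∷xs⊆upTo (there z∈) = ∈-upTo⁺ (All.lookup bnd z∈)

T-ext : ∀ {a b} → (T a → T b) → (T b → T a) → a ≡ b
T-ext {false} {false} _ _ = refl
T-ext {false} {true}  _ g = ⊥-elim (g _)
T-ext {true}  {false} f _ = ⊥-elim (f _)
T-ext {true}  {true}  _ _ = refl

trues : List Bool → ℕ
trues []           = 0
trues (true ∷ bs)  = suc (trues bs)
trues (false ∷ bs) = trues bs

trues-++ : ∀ bs cs → trues (bs ++ cs) ≡ trues bs + trues cs
trues-++ []           cs = refl
trues-++ (true ∷ bs)  cs = cong suc (trues-++ bs cs)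
trues-++ (false ∷ bs) cs = trues-++ bs cs

trues-none : ∀ {A : Set} (f : A → Bool) {xs} → All (λ x → ¬ T (f x)) xs → trues (map f xs) ≡ 0
trues-none f []                = refl
trues-none f {x ∷ _} (¬fx ∷ ¬f) with f x
... | false = trues-none f ¬f
... | true  = ⊥-elim (¬fx _)

length-filterᵇ : ∀ {A : Set} (p : A → Bool) xs → length (filterᵇ p xs) ≡ trues (map p xs)
length-filterᵇ p []       = refl
length-filterᵇ p (x ∷ xs) with p x
... | true  = cong suc (length-filterᵇ p xs)
... | false = length-filterᵇ p xs

or-++ : ∀ bs cs → or (bs ++ cs) ≡ or bs ∨ or cs
or-++ []           cs = refl
or-++ (true ∷ bs)  cs = refl
or-++ (false ∷ bs) cs = or-++ bs cs

not-∨ : ∀ a b → not (a ∨ b) ≡ not a ∧ not b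
not-∨ true  _ = refl
not-∨ false _ = refl

applyUpTo-+ : ∀ {A : Set} (f : ℕ → A) p n → applyUpTo f (p + n) ≡ applyUpTo f p ++ applyUpTo (f ∘ (p +_)) n
applyUpTo-+ f zero    n = refl
applyUpTo-+ f (suc p) n = cong (f 0 ∷_) (applyUpTo-+ (f ∘ suc) p n)

map-upTo-+ : ∀ {A : Set} (f : ℕ → A) p n → map f (upTo (p + n)) ≡ map f (upTo p) ++ map (f ∘ (p +_)) (upTo n)
map-upTo-+ f p n = begin
  map f (upTo (p + n))                                 ≡⟨ map-upTo f (p + n) ⟩
  applyUpTo f (p + n)                                  ≡⟨ applyUpTo-+ f p n ⟩
  applyUpTo f p ++ applyUpTo (f ∘ (p +_)) n            ≡⟨ sym (cong₂ _++_ (map-upTo f p) (map-upTo (f ∘ (p +_)) n)) ⟩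
  map f (upTo p) ++ map (f ∘ (p +_)) (upTo n)          ∎
  where open ≡-Reasoning

upTo-+ : ∀ p n → upTo (p + n) ≡ upTo p ++ map (p +_) (upTo n)
upTo-+ p n = trans (applyUpTo-+ (λ i → i) p n) (cong (upTo p ++_) (sym (map-upTo (p +_) n)))

take-++-≤ : ∀ {A : Set} a (xs ys : List A) → a ≤ length xs → take a (xs ++ ys) ≡ take a xs
take-++-≤ zero    xs       ys _         = refl
take-++-≤ (suc a) (x ∷ xs) ys (s≤s a≤) = cong (x ∷_) (take-++-≤ a xs ys a≤)

take-length-++ : ∀ {A : Set} b (xs ys : List A) → take (length xs + b) (xs ++ ys) ≡ xs ++ take b ys
take-length-++ b []       ys = refl
take-length-++ b (x ∷ xs) ys = cong (x ∷_) (take-length-++ b xs ys)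

zipWith-++ : ∀ {A B C : Set} (f : A → B → C) (xs xs′ : List A) (ys ys′ : List B) → length xs ≡ length ys →
             zipWith f (xs ++ xs′) (ys ++ ys′) ≡ zipWith f xs ys ++ zipWith f xs′ ys′
zipWith-++ f []       xs′ []       ys′ _   = refl
zipWith-++ f (x ∷ xs) xs′ (y ∷ ys) ys′ len = cong (f x y ∷_) (zipWith-++ f xs xs′ ys ys′ (suc-injective len))

cut⁻ : ∀ σ a → T (cut σ a) → All (_< a) (take a σ)
cut⁻ σ a t = All.map (<ᵇ⇒< _ a) (all⁺ (_<ᵇ a) (take a σ) t)

cut⁺ : ∀ σ a → All (_< a) (take a σ) → T (cut σ a)
cut⁺ σ a below = all⁻ (_<ᵇ a) (All.map <⇒<ᵇ below)

cut-full : ∀ {m σ} → IsPerm m σ → T (cut σ m)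
cut-full {m} {σ} (isPerm len bnd _) = cut⁺ σ m (subst (All (_< m)) (sym (take-all m σ (≤-reflexive len))) bnd)

q-trues : ∀ σ → q σ ≡ trues (map (cut σ ∘ suc) (upTo (length σ)))
q-trues σ = trans (length-filterᵇ (cut σ) (map suc (upTo (length σ)))) (cong trues (sym (map-∘ (upTo (length σ)))))

singletonAt : List ℕ → ℕ → Bool
singletonAt σ i = cut σ i ∧ cut σ (suc i)

_⊕[_]_ : List ℕ → ℕ → List ℕ → List ℕ
π ⊕[ p ] τ = π ++ map (p +_) τ

module Concat {p π} (πP : IsPerm p π) (τ : List ℕ) where
  open IsPerm πP renaming (len to lenπ; bnd to bndπ; uniq to uniqπ)

  private
    σ = π ⊕[ p ] τ
    n = length τ

  length-⊕ : length σ ≡ p + n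
  length-⊕ = trans (length-++ π) (cong₂ _+_ lenπ (length-map (p +_) τ))

  take-⊕ : ∀ b → take (p + b) σ ≡ π ++ map (p +_) (take b τ)
  take-⊕ b = begin
    take (p + b) σ                    ≡⟨ cong (λ l → take (l + b) σ) (sym lenπ) ⟩
    take (length π + b) σ             ≡⟨ take-length-++ b π (map (p +_) τ) ⟩
    π ++ take b (map (p +_) τ)        ≡⟨ cong (π ++_) (take-map b τ) ⟩
    π ++ map (p +_) (take b τ)        ∎
    where open ≡-Reasoning

  cut-⊕ˡ : ∀ a → a ≤ p → cut σ a ≡ cut π a
  cut-⊕ˡ a a≤p = cong (all (_<ᵇ a)) (take-++-≤ a π _ (subst (a ≤_) (sym lenπ) a≤p))

  cut-⊕ʳ : ∀ b → cut σ (p + b) ≡ cut τ b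
  cut-⊕ʳ b = T-ext to from
    where
    to : T (cut σ (p + b)) → T (cut τ b)
    to t = cut⁺ τ b (All.map (+-cancelˡ-< p _ _)
             (AllP.map⁻ (AllP.++⁻ʳ π (subst (All (_< p + b)) (take-⊕ b) (cut⁻ σ (p + b) t)))))
    from : T (cut τ b) → T (cut σ (p + b))
    from t = cut⁺ σ (p + b) (subst (All (_< p + b)) (sym (take-⊕ b))
               (AllP.++⁺ (All.map (λ x<p → ≤-trans x<p (m≤m+n p b)) bndπ)
                         (AllP.map⁺ (All.map (+-monoʳ-< p) (cut⁻ τ b t)))))

  cut-⊕ʳ-suc : ∀ b → cut σ (suc (p + b)) ≡ cut τ (suc b)
  cut-⊕ʳ-suc b = trans (cong (cut σ) (sym (+-suc p b))) (cut-⊕ʳ (suc b))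

  q-⊕ : q σ ≡ q π + q τ
  q-⊕ = begin
    q σ
      ≡⟨ q-trues σ ⟩
    trues (map (cut σ ∘ suc) (upTo (length σ)))
      ≡⟨ cong (λ l → trues (map (cut σ ∘ suc) (upTo l))) length-⊕ ⟩
    trues (map (cut σ ∘ suc) (upTo (p + n)))
      ≡⟨ cong trues (map-upTo-+ (cut σ ∘ suc) p n) ⟩
    trues (map (cut σ ∘ suc) (upTo p) ++ map (cut σ ∘ suc ∘ (p +_)) (upTo n))
      ≡⟨ trues-++ (map (cut σ ∘ suc) (upTo p)) _ ⟩
    trues (map (cut σ ∘ suc) (upTo p)) + trues (map (cut σ ∘ suc ∘ (p +_)) (upTo n))
      ≡⟨ cong₂ (λ l r → trues l + trues r)
           (map-cong-local (All.map (λ {i} i<p → cut-⊕ˡ (suc i) i<p) (all-upTo p)))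
           (map-cong cut-⊕ʳ-suc (upTo n)) ⟩
    trues (map (cut π ∘ suc) (upTo p)) + trues (map (cut τ ∘ suc) (upTo n))
      ≡⟨ cong (λ l → trues (map (cut π ∘ suc) (upTo l)) + _) (sym lenπ) ⟩
    trues (map (cut π ∘ suc) (upTo (length π))) + trues (map (cut τ ∘ suc) (upTo n))
      ≡⟨ sym (cong₂ _+_ (q-trues π) (q-trues τ)) ⟩
    q π + q τ ∎
    where open ≡-Reasoning

  isSplitType-⊕ : isSplitType σ ≡ isSplitType π ∧ isSplitType τ
  isSplitType-⊕ = begin
    not (or (map (singletonAt σ) (upTo (length σ))))
      ≡⟨ cong (λ l → not (or (map (singletonAt σ) (upTo l)))) length-⊕ ⟩
    not (or (map (singletonAt σ) (upTo (p + n))))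
      ≡⟨ cong (not ∘ or) (map-upTo-+ (singletonAt σ) p n) ⟩
    not (or (map (singletonAt σ) (upTo p) ++ map (singletonAt σ ∘ (p +_)) (upTo n)))
      ≡⟨ cong not (or-++ (map (singletonAt σ) (upTo p)) _) ⟩
    not (or (map (singletonAt σ) (upTo p)) ∨ or (map (singletonAt σ ∘ (p +_)) (upTo n)))
      ≡⟨ not-∨ (or (map (singletonAt σ) (upTo p))) _ ⟩
    not (or (map (singletonAt σ) (upTo p))) ∧ not (or (map (singletonAt σ ∘ (p +_)) (upTo n)))
      ≡⟨ cong₂ (λ l r → not (or l) ∧ not (or r))
           (map-cong-local (All.map (λ {i} i<p → cong₂ _∧_ (cut-⊕ˡ i (<⇒≤ i<p)) (cut-⊕ˡ (suc i) i<p)) (all-upTo p)))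
           (map-cong (λ b → cong₂ _∧_ (cut-⊕ʳ b) (cut-⊕ʳ-suc b)) (upTo n)) ⟩
    not (or (map (singletonAt π) (upTo p))) ∧ not (or (map (singletonAt τ) (upTo n)))
      ≡⟨ cong (λ l → not (or (map (singletonAt π) (upTo l))) ∧ isSplitType τ) (sym lenπ) ⟩
    isSplitType π ∧ isSplitType τ ∎
    where open ≡-Reasoning

  ℓ₁-⊕ : ℓ₁ σ ≡ ℓ₁ π + ℓ₁ τ
  ℓ₁-⊕ = begin
    sum (zipWith ∣_-_∣ σ (upTo (length σ)))
      ≡⟨ cong (λ l → sum (zipWith ∣_-_∣ σ (upTo l))) length-⊕ ⟩
    sum (zipWith ∣_-_∣ σ (upTo (p + n)))
      ≡⟨ cong (sum ∘ zipWith ∣_-_∣ σ) (upTo-+ p n) ⟩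
    sum (zipWith ∣_-_∣ (π ++ map (p +_) τ) (upTo p ++ map (p +_) (upTo n)))
      ≡⟨ cong sum (zipWith-++ ∣_-_∣ π _ (upTo p) _ (trans lenπ (sym (length-upTo p)))) ⟩
    sum (zipWith ∣_-_∣ π (upTo p) ++ zipWith ∣_-_∣ (map (p +_) τ) (map (p +_) (upTo n)))
      ≡⟨ sum-++ (zipWith ∣_-_∣ π (upTo p)) _ ⟩
    sum (zipWith ∣_-_∣ π (upTo p)) + sum (zipWith ∣_-_∣ (map (p +_) τ) (map (p +_) (upTo n)))
      ≡⟨ cong (sum (zipWith ∣_-_∣ π (upTo p)) +_) (cong sum shift-invariant) ⟩
    sum (zipWith ∣_-_∣ π (upTo p)) + ℓ₁ τ
      ≡⟨ cong (λ l → sum (zipWith ∣_-_∣ π (upTo l)) + ℓ₁ τ) (sym lenπ) ⟩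
    ℓ₁ π + ℓ₁ τ ∎
    where
    open ≡-Reasoning
    shift-invariant : zipWith ∣_-_∣ (map (p +_) τ) (map (p +_) (upTo n)) ≡ zipWith ∣_-_∣ τ (upTo n)
    shift-invariant = trans (zipWith-map ∣_-_∣ (p +_) (p +_) τ (upTo n))
                            (zipWith-cong (∣m+n-m+o∣≡∣n-o∣ p) τ (upTo n))

  IsPerm-⊕ : ∀ {m} → IsPerm m τ → IsPerm (p + m) σ
  IsPerm-⊕ {m} (isPerm lenτ bndτ uniqτ) =
    isPerm (trans length-⊕ (cong (p +_) lenτ))
           (AllP.++⁺ (All.map (λ x<p → ≤-trans x<p (m≤m+n p m)) bndπ) (AllP.map⁺ (All.map (+-monoʳ-< p) bndτ)))
           (Unique.++⁺ uniqπ (Unique.map⁺ (+-cancelˡ-≡ p _ _) uniqτ) disjoint)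
    where
    -- entries of π are below p, shifted entries of τ are at least p
    disjoint : ∀ {v} → ¬ (v ∈ π × v ∈ map (p +_) τ)
    disjoint (v∈π , v∈τ) with x , _ , refl ← ∈-map⁻ (p +_) v∈τ =
      <-irrefl refl (≤-trans (All.lookup bndπ v∈π) (m≤m+n p x))

least : (Q : ℕ → Bool) → ∀ m → T (Q m) → ∃ λ p → p ≤ m × T (Q p) × (∀ a → a < p → ¬ T (Q a))
least Q zero    Qm = 0 , z≤n , Qm , λ _ ()
least Q (suc m) Qm with Q 0 in Q0
... | true  = 0 , z≤n , subst T (sym Q0) _ , λ _ ()
... | false with p , p≤m , Qp , below ← least (Q ∘ suc) m Qm =
  suc p , s≤s p≤m , Qp , λ { zero _ → subst T Q0 ; (suc a) (s≤s a<p) → below a a<p }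

cut-take : ∀ σ {a p} → a ≤ p → cut (take p σ) a ≡ cut σ a
cut-take σ {a} {p} a≤p = cong (all (_<ᵇ a)) (trans (take-take a p σ) (cong (λ l → take l σ) (m≤n⇒m⊓n≡m a≤p)))

Unique-++-disjoint : ∀ {A : Set} (xs : List A) {ys} → Unique (xs ++ ys) → ∀ {y} → y ∈ ys → y ∉ xs
Unique-++-disjoint (x ∷ xs) (x∉ ∷ _) y∈ys (here refl) = All.lookup x∉ (∈-++⁺ʳ xs y∈ys) refl
Unique-++-disjoint (x ∷ xs) (_ ∷ u)  y∈ys (there y∈xs) = Unique-++-disjoint xs u y∈ys y∈xs

record FirstBlock (m : ℕ) (σ : List ℕ) : Set where
  constructor firstBlock
  field
    p           : ℕ
    π τ         : List ℕ
    0<p         : 0 < p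
    p≤m         : p ≤ m
    σ≡          : σ ≡ π ⊕[ p ] τ
    π-perm      : IsPerm p π
    τ-perm      : IsPerm (m ∸ p) τ
    π-connected : ∀ a → 0 < a → a < p → ¬ T (cut π a)

-- Every nonempty permutation has a first block: cut at the least positive cut p.
first-block : ∀ {m σ} → IsPerm (suc m) σ → FirstBlock (suc m) σ
first-block {m} {σ} P@(isPerm len bnd uniq) with p′ , p′≤m , cut-p , no-cut ← least (cut σ ∘ suc) m (cut-full P) =
  firstBlock p π τ (s≤s z≤n) p≤m σ≡ π-perm τ-perm connected
  where
  p = suc p′
  p≤m = s≤s p′≤m
  π = take p σ
  rest = drop p σ
  τ = map (_∸ p) rest
  π-perm : IsPerm p π
  π-perm = isPerm (trans (length-take p σ) (trans (cong (p ⊓_) len) (m≤n⇒m⊓n≡m p≤m)))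
                  (cut⁻ σ p cut-p) (Unique.take⁺ p uniq)
  -- π already uses every value below p, so the remaining entries are all ≥ p
  rest≥p : All (p ≤_) rest
  rest≥p = All.tabulate λ y∈rest → ≮⇒≥ λ y<p →
    Unique-++-disjoint π (subst Unique (sym (take++drop≡id p σ)) uniq) y∈rest
      (Unique-bounded⇒complete (IsPerm.len π-perm) (IsPerm.bnd π-perm) (IsPerm.uniq π-perm) y<p)
  shift-back : map (p +_) τ ≡ rest
  shift-back = trans (sym (map-∘ rest)) (map-id-local (All.map m+[n∸m]≡n rest≥p))
  σ≡ : σ ≡ π ⊕[ p ] τ
  σ≡ = trans (sym (take++drop≡id p σ)) (cong (π ++_) (sym shift-back))
  τ-perm : IsPerm (suc m ∸ p) τ
  τ-perm = isPerm (trans (length-map (_∸ p) rest) (trans (length-drop p σ) (cong (_∸ p) len)))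
                  (AllP.map⁺ (All.zipWith (λ (y< , p≤y) → ∸-monoˡ-< y< p≤y) (AllP.drop⁺ p bnd , rest≥p)))
                  (Unique.map⁻ (subst Unique (sym shift-back) (Unique.drop⁺ p uniq)))
  connected : ∀ a → 0 < a → a < p → ¬ T (cut π a)
  connected (suc a) _ (s≤s a<p′) = no-cut a a<p′ ∘ subst T (cut-take σ (<⇒≤ (s≤s a<p′)))

-- A connected permutation has exactly one part: its only cut in {1,…,p} is at p.
q-connected : ∀ {p π} → 0 < p → IsPerm p π → (∀ a → 0 < a → a < p → ¬ T (cut π a)) → q π ≡ 1
q-connected {suc p′} {π} _ πP connected = begin
  q π
    ≡⟨ q-trues π ⟩
  trues (map (cut π ∘ suc) (upTo (length π)))
    ≡⟨ cong (λ l → trues (map (cut π ∘ suc) (upTo l))) (trans (IsPerm.len πP) (+-comm 1 p′)) ⟩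
  trues (map (cut π ∘ suc) (upTo (p′ + 1)))
    ≡⟨ cong trues (map-upTo-+ (cut π ∘ suc) p′ 1) ⟩
  trues (map (cut π ∘ suc) (upTo p′) ++ cut π (suc (p′ + 0)) ∷ [])
    ≡⟨ trues-++ (map (cut π ∘ suc) (upTo p′)) _ ⟩
  trues (map (cut π ∘ suc) (upTo p′)) + trues (cut π (suc (p′ + 0)) ∷ [])
    ≡⟨ cong₂ _+_ (trues-none (cut π ∘ suc) no-inner-cut) (trues-single (subst (T ∘ cut π) (sym (+-identityʳ (suc p′))) (cut-full πP))) ⟩
  1 ∎
  where
  open ≡-Reasoning
  no-inner-cut : All (λ i → ¬ T (cut π (suc i))) (upTo p′)
  no-inner-cut = All.map (λ {i} i<p′ → connected (suc i) (s≤s z≤n) (s≤s i<p′)) (all-upTo p′)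
  trues-single : ∀ {b} → T b → trues (b ∷ []) ≡ 1
  trues-single {true} _ = refl

-- The only permutation in S_1 is a single part of size 1, so it is not a split type.
not-split-size-one : ∀ {π} → IsPerm 1 π → ¬ T (isSplitType π)
not-split-size-one {[]}          (isPerm () _ _)
not-split-size-one {_ ∷ []}      (isPerm _ (s≤s z≤n ∷ []) _) ()
not-split-size-one {_ ∷ _ ∷ _}   (isPerm () _ _)

block-size : ∀ {p π} → 0 < p → IsPerm p π → T (isSplitType π) → 2 ≤ p
block-size {1}           _ πP split = ⊥-elim (not-split-size-one πP split)
block-size {suc (suc _)} _ _  _     = s≤s (s≤s z≤n)

record Peel (m : ℕ) (σ : List ℕ) : Set where
  field
    p           : ℕ
    π τ         : List ℕ
    2≤p         : 2 ≤ p
    p≤m         : p ≤ m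
    σ≡          : σ ≡ π ⊕[ p ] τ
    π-perm      : IsPerm p π
    π-connected : ∀ a → 0 < a → a < p → ¬ T (cut π a)
    τ-perm      : IsPerm (m ∸ p) τ
    τ-split     : T (isSplitType τ)
    q≡          : q σ ≡ suc (q τ)
    ℓ₁≡         : ℓ₁ σ ≡ ℓ₁ π + ℓ₁ τ

peel : ∀ {m σ} → IsPerm (suc m) σ → T (isSplitType σ) → Peel (suc m) σ
peel P split with firstBlock p π τ 0<p p≤m σ≡ πP τP connected ← first-block P
  with π-split , τ-split ← Equivalence.to T-∧ (subst T (trans (cong isSplitType σ≡) (Concat.isSplitType-⊕ πP τ)) split) =
  record
    { p = p ; π = π ; τ = τ ; 2≤p = block-size 0<p πP π-split ; p≤m = p≤m ; σ≡ = σ≡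
    ; π-perm = πP ; π-connected = connected ; τ-perm = τP ; τ-split = τ-split
    ; q≡ = trans (cong q σ≡) (trans (Concat.q-⊕ πP τ) (cong (_+ q τ) (q-connected 0<p πP connected)))
    ; ℓ₁≡ = trans (cong ℓ₁ σ≡) (Concat.ℓ₁-⊕ πP τ)
    }

all-holds : ∀ {A : Set} (f : A → Bool) {xs} → T (all f xs) → ∀ {x} → x ∈ xs → T (f x)
all-holds f {xs} t = All.lookup (all⁺ f xs t)

small-displacement : ∀ {p π} → p ≤ 6 → IsPerm p π → 2 * ℓ₁ π ≤ p * p
small-displacement {p} {π} p≤6 πP = ≤ᵇ⇒≤ (2 * ℓ₁ π) (p * p) (all-holds (bounded p) (enumerated p p≤6) (∈-perms⁺ πP))
  where
  bounded : ℕ → List ℕ → Bool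
  bounded p π = 2 * ℓ₁ π ≤ᵇ p * p
  enumerated : ∀ p → p ≤ 6 → T (all (bounded p) (perms p))
  enumerated 0 _ = _
  enumerated 1 _ = _
  enumerated 2 _ = _
  enumerated 3 _ = _
  enumerated 4 _ = _
  enumerated 5 _ = _
  enumerated 6 _ = _
  enumerated (suc (suc (suc (suc (suc (suc (suc _))))))) (s≤s (s≤s (s≤s (s≤s (s≤s (s≤s ()))))))

transposition : List ℕ
transposition = 1 ∷ 0 ∷ []

-- Read off from the enumeration of S_2 = {12, 21}: 12 has a cut at 1.
connected-size-two : ∀ {π} → IsPerm 2 π → ¬ T (cut π 1) → π ≡ transposition
connected-size-two πP with ∈-perms⁺ πP
... | here refl         = λ ¬cut → ⊥-elim (¬cut _)
... | there (here refl) = λ _ → refl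

startsWith1 : List ℕ → Bool
startsWith1 []      = false
startsWith1 (x ∷ _) = x ≡ᵇ 1

-- The permutations of S_6 of maximal displacement ℓ₁ = 18.
abstract
  Extremal₆ : List (List ℕ)
  Extremal₆ = filterᵇ (λ π → ℓ₁ π ≡ᵇ 18) (perms 6)

  Extremal₆-length : length Extremal₆ ≡ 36
  Extremal₆-length = refl

  Extremal₆-unique : Unique Extremal₆
  Extremal₆-unique = Unique.filter⁺ (T? ∘ λ π → ℓ₁ π ≡ᵇ 18) (perms-unique 6)

  ∈-Extremal₆⁺ : ∀ {π} → IsPerm 6 π → ℓ₁ π ≡ 18 → π ∈ Extremal₆
  ∈-Extremal₆⁺ πP ℓ≡ = ∈-filter⁺ (T? ∘ λ π → ℓ₁ π ≡ᵇ 18) (∈-perms⁺ πP) (≡⇒≡ᵇ _ _ ℓ≡)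

  ∈-Extremal₆⁻ : ∀ {π} → π ∈ Extremal₆ → IsPerm 6 π × ℓ₁ π ≡ 18
  ∈-Extremal₆⁻ π∈ with π∈perms , ℓ≡ ← ∈-filter⁻ (T? ∘ λ π → ℓ₁ π ≡ᵇ 18) {xs = perms 6} π∈ =
    ∈-perms⁻ π∈perms , ≡ᵇ⇒≡ _ _ ℓ≡

  Extremal₆-connected : ∀ {π} → π ∈ Extremal₆ → T ((q π ≡ᵇ 1) ∧ isSplitType π)
  Extremal₆-connected = all-holds (λ π → (q π ≡ᵇ 1) ∧ isSplitType π) _

  Extremal₆-head : ∀ {π} → π ∈ Extremal₆ → T (not (startsWith1 π))
  Extremal₆-head = all-holds (not ∘ startsWith1) _

-- If a first part of size p = 2 + r is followed by a rest of size 2t + h′, the whole has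
-- size 2(t + 1) + (r + h′): the excess over twice the number of parts is additive.
excess-size-step : ∀ {p M t h′} → 2 ≤ p → p ≤ M → M ∸ p ≡ 2 * t + h′ → M ≡ 2 * suc t + (p ∸ 2 + h′)
excess-size-step {suc (suc r)} {M} {t} {h′} (s≤s (s≤s z≤n)) p≤M rest≡ = begin
  M                               ≡⟨ sym (m+[n∸m]≡n p≤M) ⟩
  (2 + r) + (M ∸ (2 + r))         ≡⟨ cong ((2 + r) +_) rest≡ ⟩
  (2 + r) + (2 * t + h′)          ≡⟨ regroup r t h′ ⟩
  2 * suc t + (r + h′)            ∎
  where
  open ≡-Reasoning
  regroup : ∀ r t h′ → (2 + r) + (2 * t + h′) ≡ 2 * suc t + (r + h′)
  regroup = solve-∀

excess-split : ∀ {p M t h′ e} → 2 ≤ p → p ≤ M → M ∸ p ≡ 2 * t + h′ → M ≡ 2 * suc t + e → p ∸ 2 + h′ ≡ e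
excess-split {t = t} {h′} 2≤p p≤M rest≡ M≡ = +-cancelˡ-≡ (2 * suc t) _ _ (trans (sym (excess-size-step {t = t} {h′} 2≤p p≤M rest≡)) M≡)

-- Combining 2ℓ₁(π) ≤ p² for the first part with the bound for the rest gives the bound
-- for the whole, since r² + h′² ≤ (r + h′)².
excess-bound-step : ∀ {p} h′ t a b → 2 ≤ p → p ∸ 2 + h′ ≤ 4 →
                    (p ≤ 6 → 2 * a ≤ p * p) → (h′ ≤ 4 → 2 * b ≤ h′ * h′ + 4 * h′ + 4 * t) →
                    2 * (a + b) ≤ (p ∸ 2 + h′) * (p ∸ 2 + h′) + 4 * (p ∸ 2 + h′) + 4 * suc t
excess-bound-step {suc (suc r)} h′ t a b (s≤s (s≤s z≤n)) small first rest = begin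
  2 * (a + b)                                             ≡⟨ *-distribˡ-+ 2 a b ⟩
  2 * a + 2 * b                                           ≤⟨ +-mono-≤ (first (s≤s (s≤s (≤-trans (m≤m+n r h′) small))))
                                                                       (rest (≤-trans (m≤n+m h′ r) small)) ⟩
  (2 + r) * (2 + r) + (h′ * h′ + 4 * h′ + 4 * t)          ≡⟨ expand r h′ t ⟩
  (r * r + h′ * h′) + (4 * (r + h′) + 4 * suc t)          ≤⟨ +-monoˡ-≤ _ squares ⟩
  (r + h′) * (r + h′) + (4 * (r + h′) + 4 * suc t)        ≡⟨ sym (+-assoc ((r + h′) * (r + h′)) _ _) ⟩
  (r + h′) * (r + h′) + 4 * (r + h′) + 4 * suc t          ∎
  where
  open ≤-Reasoning
  expand : ∀ r h t → (2 + r) * (2 + r) + (h * h + 4 * h + 4 * t) ≡ (r * r + h * h) + (4 * (r + h) + 4 * suc t)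
  expand = solve-∀
  square-sum : ∀ r h → (r + h) * (r + h) ≡ (r * r + h * h) + 2 * (r * h)
  square-sum = solve-∀
  squares : r * r + h′ * h′ ≤ (r + h′) * (r + h′)
  squares = subst (r * r + h′ * h′ ≤_) (sym (square-sum r h′)) (m≤m+n _ _)

record Excess (m : ℕ) (σ : List ℕ) : Set where
  constructor excessOf
  field
    h     : ℕ
    m≡    : m ≡ 2 * q σ + h
    bound : h ≤ 4 → 2 * ℓ₁ σ ≤ h * h + 4 * h + 4 * q σ

excess : ∀ {m σ} → IsPerm m σ → T (isSplitType σ) → Excess m σ
excess P = within _ ≤-refl P
  where
  within : ∀ n {m σ} → m ≤ n → IsPerm m σ → T (isSplitType σ) → Excess m σ
  within n       {zero}  {[]}    _ _               _     = excessOf 0 refl (λ _ → z≤n)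
  within n       {zero}  {_ ∷ _} _ (isPerm () _ _) _
  within (suc n) {suc m} {σ}     (s≤s m≤n) P split = from-peel (peel P split)
    where
    from-peel : Peel (suc m) σ → Excess (suc m) σ
    from-peel pl = excessOf (p ∸ 2 + h′)
      (trans (excess-size-step {t = q τ} 2≤p p≤m rest≡) (cong (λ x → 2 * x + (p ∸ 2 + h′)) (sym q≡)))
      (λ small → subst₂ (λ x y → 2 * x ≤ (p ∸ 2 + h′) * (p ∸ 2 + h′) + 4 * (p ∸ 2 + h′) + 4 * y) (sym ℓ₁≡) (sym q≡)
                   (excess-bound-step h′ (q τ) (ℓ₁ π) (ℓ₁ τ) 2≤p small (λ p≤6 → small-displacement p≤6 π-perm) rest-bound))
      where
      open Peel pl
      rest-size : suc m ∸ p ≤ n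
      rest-size = ≤-trans (∸-monoʳ-≤ (suc m) (≤-trans (s≤s z≤n) 2≤p)) m≤n
      open Excess (within n rest-size τ-perm τ-split) renaming (h to h′; m≡ to rest≡; bound to rest-bound)

too-small⇒large : ∀ k t h → ¬ (k + t ≤ 2 * t + h + 3) → t + h + 4 ≤ k
too-small⇒large k t h k+t≰ = +-cancelʳ-≤ t (t + h + 4) k
  (subst (_≤ k + t) (shuffle t h) (subst (_≤ k + t) (sym (+-suc (2 * t + h) 3)) (≰⇒> k+t≰)))
  where
  shuffle : ∀ t h → 2 * t + h + 4 ≡ t + h + 4 + t
  shuffle = solve-∀

extremal-room : ∀ t h d → t + h + 4 + d ≤ t + 8 → h + d ≤ 4
extremal-room t h d ≤t+8 = +-cancelˡ-≤ (t + 4) (h + d) 4 (subst₂ _≤_ (shuffle t h d) (sym (+-assoc t 4 4)) ≤t+8)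
  where
  shuffle : ∀ t h d → t + h + 4 + d ≡ t + 4 + (h + d)
  shuffle = solve-∀

extremal-gap : ∀ t h d → 4 * (t + h + 4 + d) ≤ h * h + 4 * h + 4 * t → 16 + 4 * d ≤ h * h
extremal-gap t h d ≤ = +-cancelʳ-≤ (4 * h + 4 * t) (16 + 4 * d) (h * h) (subst₂ _≤_ (expand t h d) (+-assoc (h * h) _ _) ≤)
  where
  expand : ∀ t h d → 4 * (t + h + 4 + d) ≡ 16 + 4 * d + (4 * h + 4 * t)
  expand = solve-∀

square-forces-four : ∀ h d → h + d ≤ 4 → 16 + 4 * d ≤ h * h → h ≡ 4 × d ≡ 0
square-forces-four 4 0 _ _ = refl , refl
square-forces-four 0 _ _ ()
square-forces-four 1 _ _ (s≤s ())
square-forces-four 2 _ _ (s≤s (s≤s (s≤s (s≤s ()))))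
square-forces-four 3 _ _ (s≤s (s≤s (s≤s (s≤s (s≤s (s≤s (s≤s (s≤s (s≤s ())))))))))
square-forces-four 4 (suc d) (s≤s (s≤s (s≤s (s≤s ())))) _
square-forces-four (suc (suc (suc (suc (suc h))))) _ (s≤s (s≤s (s≤s (s≤s ())))) _

-- Then k = t + h + 4 + d with h + d ≤ 4, and the key inequality
-- 4k ≤ h² + 4h + 4t becomes 16 + 4d ≤ h², which forces h = 4 and d = 0.
excess-extremal : ∀ k t h → k ≤ t + 8 → (h ≤ 4 → 4 * k ≤ h * h + 4 * h + 4 * t) →
                  ¬ (k + t ≤ 2 * t + h + 3) → h ≡ 4 × k ≡ t + 8
excess-extremal k t h k≤t+8 key too-small with m≤n⇒∃[o]m+o≡n (too-small⇒large k t h too-small)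
... | d , refl = conclude (square-forces-four h d room (extremal-gap t h d (key (≤-trans (m≤m+n h d) room))))
  where
  room : h + d ≤ 4
  room = extremal-room t h d k≤t+8
  conclude : h ≡ 4 × d ≡ 0 → h ≡ 4 × t + h + 4 + d ≡ t + 8
  conclude (refl , refl) = refl , trans (+-identityʳ (t + 4 + 4)) (+-assoc t 4 4)

no-excess : ∀ {p h′} → 2 ≤ p → p ∸ 2 + h′ ≡ 0 → p ≡ 2 × h′ ≡ 0
no-excess {2}                 {0}     _           _  = refl , refl
no-excess {2}                 {suc _} _           ()
no-excess {suc (suc (suc _))} {_}     _           ()
no-excess {1}                 {_}     (s≤s ())    _

displacement-too-small : ∀ t a b c₁ c₂ → a + b ≡ 2 * t + 18 → 2 * a ≤ c₁ → 2 * b ≤ c₂ + 4 * t → c₁ + c₂ < 36 → ⊥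
displacement-too-small t a b c₁ c₂ a+b≡ 2a≤ 2b≤ small = <⇒≱ small (+-cancelʳ-≤ (4 * t) 36 (c₁ + c₂) (begin
  36 + 4 * t           ≡⟨ double t ⟩
  2 * (2 * t + 18)     ≡⟨ cong (2 *_) (sym a+b≡) ⟩
  2 * (a + b)          ≡⟨ *-distribˡ-+ 2 a b ⟩
  2 * a + 2 * b        ≤⟨ +-mono-≤ 2a≤ 2b≤ ⟩
  c₁ + (c₂ + 4 * t)    ≡⟨ sym (+-assoc c₁ c₂ (4 * t)) ⟩
  c₁ + c₂ + 4 * t      ∎))
  where
  open ≤-Reasoning
  double : ∀ t → 36 + 4 * t ≡ 2 * (2 * t + 18)
  double = solve-∀

-- A split type of size 2(t+1) + 4 with t + 1 parts and ℓ₁ = 2t + 18, peeled into a first part of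
-- size p and a rest of excess h′ (so p - 2 + h′ = 4), has p = 2 or p = 6: for p = 3, 4, 5 the key
-- inequality leaves too little displacement.
level-cases : ∀ p h′ t a b → 2 ≤ p → p ∸ 2 + h′ ≡ 4 → a + b ≡ 2 * t + 18 →
              (p ≤ 6 → 2 * a ≤ p * p) → (h′ ≤ 4 → 2 * b ≤ h′ * h′ + 4 * h′ + 4 * t) →
              (p ≡ 2 × h′ ≡ 4) ⊎ (p ≡ 6 × h′ ≡ 0)
level-cases 2 _ t a b _ refl _   _     _    = inj₁ (refl , refl)
level-cases 3 _ t a b _ refl a+b first rest =
  ⊥-elim (displacement-too-small t a b 9 21 a+b (first (s≤s (s≤s (s≤s z≤n)))) (rest (s≤s (s≤s (s≤s z≤n)))) (s≤s (m≤m+n 30 5)))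
level-cases 4 _ t a b _ refl a+b first rest =
  ⊥-elim (displacement-too-small t a b 16 12 a+b (first (s≤s (s≤s (s≤s (s≤s z≤n))))) (rest (s≤s (s≤s z≤n))) (s≤s (m≤m+n 28 7)))
level-cases 5 _ t a b _ refl a+b first rest =
  ⊥-elim (displacement-too-small t a b 25 5 a+b (first (s≤s (s≤s (s≤s (s≤s (s≤s z≤n)))))) (rest (s≤s z≤n)) (s≤s (m≤m+n 30 5)))
level-cases 6 _ t a b _ refl _   _     _    = inj₂ (refl , refl)
level-cases (suc (suc (suc (suc (suc (suc (suc _))))))) _ _ _ _ _ () _ _ _
level-cases 1 _ _ _ _ (s≤s ()) _ _ _ _

record SplitType (R m t : ℕ) (σ : List ℕ) : Set where
  constructor splitType
  field
    perm  : IsPerm m σ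
    split : T (isSplitType σ)
    ℓ₁≡   : ℓ₁ σ ≡ R
    q≡    : q σ ≡ t

counted : ℕ → ℕ → List ℕ → Bool
counted R t σ = isSplitType σ ∧ (ℓ₁ σ ≡ᵇ R) ∧ (q σ ≡ᵇ t)

SplitTypes : ℕ → ℕ → ℕ → List (List ℕ)
SplitTypes R m t = filterᵇ (counted R t) (perms m)

∈-SplitTypes⁻ : ∀ {R m t σ} → σ ∈ SplitTypes R m t → SplitType R m t σ
∈-SplitTypes⁻ {R} {m} {t} σ∈ with σ∈perms , c ← ∈-filter⁻ (T? ∘ counted R t) {xs = perms m} σ∈
  with split , c′ ← Equivalence.to T-∧ c
  with ℓ₁≡ , q≡ ← Equivalence.to T-∧ c′ = splitType (∈-perms⁻ σ∈perms) split (≡ᵇ⇒≡ _ _ ℓ₁≡) (≡ᵇ⇒≡ _ _ q≡)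

∈-SplitTypes⁺ : ∀ {R m t σ} → SplitType R m t σ → σ ∈ SplitTypes R m t
∈-SplitTypes⁺ {R} {m} {t} (splitType P split ℓ₁≡ q≡) =
  ∈-filter⁺ (T? ∘ counted R t) {xs = perms m} (∈-perms⁺ P)
    (Equivalence.from T-∧ (split , Equivalence.from T-∧ (≡⇒≡ᵇ _ _ ℓ₁≡ , ≡⇒≡ᵇ _ _ q≡)))

SplitTypes-unique : ∀ R m t → Unique (SplitTypes R m t)
SplitTypes-unique R m t = Unique.filter⁺ (T? ∘ counted R t) (perms-unique m)

SplitType-⊕ : ∀ {p π R m t τ} → IsPerm p π → T (isSplitType π) → q π ≡ 1 →
              SplitType R m t τ → SplitType (ℓ₁ π + R) (p + m) (suc t) (π ⊕[ p ] τ)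
SplitType-⊕ {π = π} {τ = τ} πP π-split qπ≡1 (splitType τP τ-split ℓ₁≡ q≡) =
  splitType (IsPerm-⊕ τP)
            (subst T (sym isSplitType-⊕) (Equivalence.from T-∧ (π-split , τ-split)))
            (trans ℓ₁-⊕ (cong (ℓ₁ π +_) ℓ₁≡))
            (trans q-⊕ (cong₂ _+_ qπ≡1 q≡))
  where open Concat πP τ

transposition-perm : IsPerm 2 transposition
transposition-perm = ∈-perms⁻ (there (here refl))

transpositions : ℕ → List ℕ
transpositions zero    = []
transpositions (suc n) = transposition ⊕[ 2 ] transpositions n

transpositions-type : ∀ n → SplitType (2 * n) (2 * n) n (transpositions n)
transpositions-type zero    = splitType (isPerm refl [] []) _ refl refl
transpositions-type (suc n) =
  subst₂ (λ R m → SplitType R m (suc n) (transpositions (suc n))) (double n) (double n)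
    (SplitType-⊕ transposition-perm _ refl (transpositions-type n))
  where
  double : ∀ n → 2 + 2 * n ≡ 2 * suc n
  double = solve-∀

-- A split type in S_{2n} with n parts has no excess, so each part is a connected permutation
-- of size 2, i.e. the transposition: the split type is 21 43 65 ….
transpositions-unique : ∀ n {σ} → IsPerm (2 * n) σ → T (isSplitType σ) → q σ ≡ n → σ ≡ transpositions n
transpositions-unique zero    {[]}    _               _     _   = refl
transpositions-unique zero    {_ ∷ _} (isPerm () _ _) _     _
transpositions-unique (suc n) {σ}     P               split q≡n = from-peel (peel P split)
  where
  from-peel : Peel (2 * suc n) σ → σ ≡ transpositions (suc n)
  from-peel pl = conclude (no-excess 2≤p (excess-split {t = q τ} 2≤p p≤m rest≡ (trans (sym (+-identityʳ (2 * suc n))) (cong (λ x → 2 * suc x + 0) (sym qτ≡n)))))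
    where
    open Peel pl
    open Excess (excess τ-perm τ-split) renaming (h to h′; m≡ to rest≡)
    qτ≡n : q τ ≡ n
    qτ≡n = suc-injective (trans (sym q≡) q≡n)
    conclude : p ≡ 2 × h′ ≡ 0 → σ ≡ transpositions (suc n)
    conclude (p≡2 , h′≡0) = trans σ≡ (trans (cong (π ⊕[_] τ) p≡2) (cong₂ _⊕[ 2 ]_ π≡ τ≡))
      where
      π≡ : π ≡ transposition
      π≡ = connected-size-two (subst (λ x → IsPerm x π) p≡2 π-perm) (π-connected 1 (s≤s z≤n) 2≤p)
      τ-size : 2 * suc n ∸ p ≡ 2 * n
      τ-size = trans rest≡ (trans (cong₂ (λ x y → 2 * x + y) qτ≡n h′≡0) (+-identityʳ (2 * n)))
      τ≡ : τ ≡ transpositions n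
      τ≡ = transpositions-unique n (subst (λ x → IsPerm x τ) τ-size τ-perm) τ-split qτ≡n

-- Level t of the extremal family: split types in S_{2t+4} with t parts and ℓ₁ = 2(t + 8),
-- i.e. the permutations counted by β(2k, 2k - 12, k - 8) for k = t + 8.
ExtremalLevel : ℕ → List (List ℕ)
ExtremalLevel t = SplitTypes (2 * (t + 8)) (2 * t + 4) t

NextLevel : ℕ → List (List ℕ)
NextLevel t = map (transposition ⊕[ 2 ]_) (ExtremalLevel t) ++ map (_⊕[ 6 ] transpositions t) Extremal₆

NextLevel-length : ∀ t → length (NextLevel t) ≡ length (ExtremalLevel t) + 36
NextLevel-length t =
  trans (length-++ (map (transposition ⊕[ 2 ]_) (ExtremalLevel t)))
        (cong₂ _+_ (length-map _ (ExtremalLevel t)) (trans (length-map _ Extremal₆) Extremal₆-length))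

NextLevel-unique : ∀ t → Unique (NextLevel t)
NextLevel-unique t =
  Unique.++⁺ (Unique.map⁺ after-transposition-injective (SplitTypes-unique (2 * (t + 8)) (2 * t + 4) t))
             (Unique.map⁺ (λ {x} {y} → ++-cancelʳ (map (6 +_) (transpositions t)) x y) Extremal₆-unique)
             disjoint
  where
  after-transposition-injective : ∀ {x y} → transposition ⊕[ 2 ] x ≡ transposition ⊕[ 2 ] y → x ≡ y
  after-transposition-injective e = map-injective (λ {x} {y} → +-cancelˡ-≡ 2 x y) (++-cancelˡ transposition _ _ e)
  -- the first family begins with the entry 1, the second one does not
  first-entries-differ : ∀ {τ} π → IsPerm 6 π → T (not (startsWith1 π)) → transposition ⊕[ 2 ] τ ≢ π ⊕[ 6 ] transpositions t
  first-entries-differ (_ ∷ _) _ not-1 e = subst (T ∘ not) (sym (cong startsWith1 e)) not-1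
  first-entries-differ []      (isPerm () _ _)
  disjoint : ∀ {v} → ¬ (v ∈ map (transposition ⊕[ 2 ]_) (ExtremalLevel t) × v ∈ map (_⊕[ 6 ] transpositions t) Extremal₆)
  disjoint (v∈₁ , v∈₂) with τ , _ , refl ← ∈-map⁻ _ v∈₁
    with π , π∈ , v≡ ← ∈-map⁻ _ v∈₂ = first-entries-differ π (proj₁ (∈-Extremal₆⁻ π∈)) (Extremal₆-head π∈) v≡

NextLevel⊆ : ∀ t {σ} → σ ∈ NextLevel t → σ ∈ ExtremalLevel (suc t)
NextLevel⊆ t σ∈ with ∈-++⁻ (map (transposition ⊕[ 2 ]_) (ExtremalLevel t)) σ∈
... | inj₁ σ∈₁ with τ , τ∈ , refl ← ∈-map⁻ _ σ∈₁ =
  ∈-SplitTypes⁺ (subst₂ (λ R m → SplitType R m (suc t) (transposition ⊕[ 2 ] τ)) (ℓ₁-step t) (size-step t)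
                  (SplitType-⊕ transposition-perm _ refl (∈-SplitTypes⁻ τ∈)))
  where
  ℓ₁-step : ∀ t → 2 + 2 * (t + 8) ≡ 2 * (suc t + 8)
  ℓ₁-step = solve-∀
  size-step : ∀ t → 2 + (2 * t + 4) ≡ 2 * suc t + 4
  size-step = solve-∀
... | inj₂ σ∈₂ with π , π∈ , refl ← ∈-map⁻ _ σ∈₂
  with πP , ℓ₁π ← ∈-Extremal₆⁻ π∈
  with q≡1 , π-split ← Equivalence.to T-∧ (Extremal₆-connected π∈) =
  ∈-SplitTypes⁺ (subst₂ (λ R m → SplitType R m (suc t) (π ⊕[ 6 ] transpositions t)) (trans (cong (_+ 2 * t) ℓ₁π) (ℓ₁-step t)) (size-step t)
                  (SplitType-⊕ πP π-split (≡ᵇ⇒≡ _ _ q≡1) (transpositions-type t)))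
  where
  ℓ₁-step : ∀ t → 18 + 2 * t ≡ 2 * (suc t + 8)
  ℓ₁-step = solve-∀
  size-step : ∀ t → 6 + 2 * t ≡ 2 * suc t + 4
  size-step = solve-∀

⊆NextLevel : ∀ t {σ} → σ ∈ ExtremalLevel (suc t) → σ ∈ NextLevel t
⊆NextLevel t {σ} σ∈ = from-type (∈-SplitTypes⁻ σ∈)
  where
  from-type : SplitType (2 * (suc t + 8)) (2 * suc t + 4) (suc t) σ → σ ∈ NextLevel t
  from-type (splitType P split ℓ₁σ qσ) = from-peel (peel P split)
    where
    from-peel : Peel (2 * suc t + 4) σ → σ ∈ NextLevel t
    from-peel pl = conclude (level-cases p h′ t (ℓ₁ π) (ℓ₁ τ) 2≤p excess≡4 ℓ₁-sum
                              (λ p≤6 → small-displacement p≤6 π-perm) (subst (λ x → h′ ≤ 4 → 2 * ℓ₁ τ ≤ h′ * h′ + 4 * h′ + 4 * x) qτ≡t rest-bound))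
      where
      open Peel pl
      open Excess (excess τ-perm τ-split) renaming (h to h′; m≡ to rest≡; bound to rest-bound)
      qτ≡t : q τ ≡ t
      qτ≡t = suc-injective (trans (sym q≡) qσ)
      excess≡4 : p ∸ 2 + h′ ≡ 4
      excess≡4 = excess-split {t = q τ} 2≤p p≤m rest≡ (cong (λ x → 2 * suc x + 4) (sym qτ≡t))
      ℓ₁-sum : ℓ₁ π + ℓ₁ τ ≡ 2 * t + 18
      ℓ₁-sum = trans (sym ℓ₁≡) (trans ℓ₁σ (double t))
        where
        double : ∀ t → 2 * (suc t + 8) ≡ 2 * t + 18
        double = solve-∀
      τ-size : ∀ {e} → h′ ≡ e → 2 * suc t + 4 ∸ p ≡ 2 * t + e
      τ-size h′≡e = trans rest≡ (cong₂ (λ x y → 2 * x + y) qτ≡t h′≡e)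
      conclude : (p ≡ 2 × h′ ≡ 4) ⊎ (p ≡ 6 × h′ ≡ 0) → σ ∈ NextLevel t
      conclude (inj₁ (p≡2 , h′≡4)) =
        subst (_∈ NextLevel t) (sym (trans σ≡ (cong₂ (λ x y → x ⊕[ y ] τ) π≡ p≡2))) (∈-++⁺ˡ (∈-map⁺ _ τ∈))
        where
        π≡ : π ≡ transposition
        π≡ = connected-size-two (subst (λ x → IsPerm x π) p≡2 π-perm) (π-connected 1 (s≤s z≤n) 2≤p)
        ℓ₁τ : ℓ₁ τ ≡ 2 * (t + 8)
        ℓ₁τ = +-cancelˡ-≡ 2 _ _ (trans (cong (λ x → ℓ₁ x + ℓ₁ τ) (sym π≡)) (trans ℓ₁-sum (regroup t)))
          where
          regroup : ∀ t → 2 * t + 18 ≡ 2 + 2 * (t + 8)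
          regroup = solve-∀
        τ∈ : τ ∈ ExtremalLevel t
        τ∈ = ∈-SplitTypes⁺ (splitType (subst (λ x → IsPerm x τ) (τ-size h′≡4) τ-perm) τ-split ℓ₁τ qτ≡t)
      conclude (inj₂ (p≡6 , h′≡0)) =
        subst (_∈ NextLevel t) (sym (trans σ≡ (cong₂ (λ x y → π ⊕[ x ] y) p≡6 τ≡))) (∈-++⁺ʳ _ (∈-map⁺ _ π∈))
        where
        τ≡ : τ ≡ transpositions t
        τ≡ = transpositions-unique t (subst (λ x → IsPerm x τ) (trans (τ-size h′≡0) (+-identityʳ (2 * t))) τ-perm) τ-split qτ≡t
        ℓ₁π : ℓ₁ π ≡ 18
        ℓ₁π = +-cancelʳ-≡ (2 * t) _ _
          (trans (cong (ℓ₁ π +_) (sym (trans (cong ℓ₁ τ≡) (SplitType.ℓ₁≡ (transpositions-type t)))))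
                 (trans ℓ₁-sum (+-comm (2 * t) 18)))
        π∈ : π ∈ Extremal₆
        π∈ = ∈-Extremal₆⁺ (subst (λ x → IsPerm x π) p≡6 π-perm) ℓ₁π

-- Each level adds the 36 extremal permutations of S_6, and level 0 is empty (a permutation
-- of S_4 has at least one part); hence level t has exactly 36t members.
ExtremalLevel-length : ∀ t → length (ExtremalLevel t) ≡ 36 * t
ExtremalLevel-length zero    = refl
ExtremalLevel-length (suc t) = begin
  length (ExtremalLevel (suc t))   ≡⟨ sym (Unique-≈⇒length≡ (NextLevel-unique t) (SplitTypes-unique (2 * (suc t + 8)) (2 * suc t + 4) (suc t)) (NextLevel⊆ t) (⊆NextLevel t)) ⟩
  length (NextLevel t)             ≡⟨ NextLevel-length t ⟩
  length (ExtremalLevel t) + 36    ≡⟨ cong (_+ 36) (ExtremalLevel-length t) ⟩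
  36 * t + 36                      ≡⟨ +-comm (36 * t) 36 ⟩
  36 + 36 * t                      ≡⟨ sym (*-suc 36 t) ⟩
  36 * suc t                       ∎
  where open ≡-Reasoning

nonempty-member : ∀ {A : Set} (xs : List A) → length xs ≢ 0 → ∃ λ x → x ∈ xs
nonempty-member []      length≢0 = ⊥-elim (length≢0 refl)
nonempty-member (x ∷ _) _        = x , here refl

β≢0⇒splitType : ∀ {R m t} → β R m t ≢ 0 → ∃ λ σ → SplitType R m t σ
β≢0⇒splitType {R} {m} {t} β≢0 with σ , σ∈ ← nonempty-member (SplitTypes R m t) β≢0 = σ , ∈-SplitTypes⁻ σ∈

β-extremal : ∀ t → β (2 * (t + 8)) (2 * (t + 8) ∸ 12) (t + 8 ∸ 8) ≡ 36 * (t + 8 ∸ 8)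
β-extremal t = begin
  β (2 * (t + 8)) (2 * (t + 8) ∸ 12) (t + 8 ∸ 8)   ≡⟨ cong₂ (β (2 * (t + 8))) size (m+n∸n≡m t 8) ⟩
  length (ExtremalLevel t)                          ≡⟨ ExtremalLevel-length t ⟩
  36 * t                                            ≡⟨ cong (36 *_) (sym (m+n∸n≡m t 8)) ⟩
  36 * (t + 8 ∸ 8)                                  ∎
  where
  open ≡-Reasoning
  size : 2 * (t + 8) ∸ 12 ≡ 2 * t + 4
  size = trans (cong (_∸ 12) (regroup t)) (m+n∸n≡m (2 * t + 4) 12)
    where
    regroup : ∀ t → 2 * (t + 8) ≡ 2 * t + 4 + 12
    regroup = solve-∀

extremal-values : ∀ k m q′ h → 1 ≤ q′ → m ≡ 2 * q′ + h → h ≡ 4 × k ≡ q′ + 8 →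
  q′ + 8 ≡ k × m + 12 ≡ 2 * k × 9 ≤ k × β (2 * k) (2 * k ∸ 12) (k ∸ 8) ≡ 36 * (k ∸ 8)
extremal-values _ m q′ _ 1≤q′ m≡ (refl , refl) = refl , trans (cong (_+ 12) m≡) (size q′) , +-monoˡ-≤ 8 1≤q′ , β-extremal q′
  where
  size : ∀ q′ → 2 * q′ + 4 + 12 ≡ 2 * (q′ + 8)
  size = solve-∀

lemma5p2 : (k m q′ : ℕ) → 1 ≤ k → 1 ≤ m → 1 ≤ q′ → k ≤ q′ + 8 → β (2 * k) m q′ ≢ 0 →
    (k + q′ ≤ m + 3) ⊎
    (q′ + 8 ≡ k × m + 12 ≡ 2 * k × 9 ≤ k × β (2 * k) (2 * k ∸ 12) (k ∸ 8) ≡ 36 * (k ∸ 8))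
lemma5p2 k m q′ _ _ 1≤q′ k≤q′+8 β≢0 with k + q′ ≤? m + 3
... | yes fits = inj₁ fits
... | no too-small
  with σ , splitType P split ℓ₁≡ q≡ ← β≢0⇒splitType β≢0
  with excessOf h m≡ bound ← excess P split =
  inj₂ (extremal-values k m q′ h 1≤q′ m≡q′ (excess-extremal k q′ h k≤q′+8 key (too-small ∘ subst (λ x → k + q′ ≤ x + 3) (sym m≡q′))))
  where
  m≡q′ : m ≡ 2 * q′ + h
  m≡q′ = trans m≡ (cong (λ x → 2 * x + h) q≡)
  key : h ≤ 4 → 4 * k ≤ h * h + 4 * h + 4 * q′
  key h≤4 = subst₂ (λ x y → x ≤ h * h + 4 * h + 4 * y) (trans (cong (2 *_) ℓ₁≡) (double k)) q≡ (bound h≤4)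
    where
    double : ∀ k → 2 * (2 * k) ≡ 4 * k
    double = solve-∀
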